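{- Let $n,p>0$ be integers and let $\mathbf{A}=\mathbf{A}^{p+1}_{n+1}$ be as in the context; write $\langle\mathbf{j},\mathbf{q}\rangle$ for $\langle(j,0),q\rangle$. Then for every $a\in A$: (a) $a\vee\sim(a^p)\in\mathrm{Rad}(\mathbf{A})$; (b) if $p\le n$, then $a\not\ge\langle\mathbf{0},\mathbf{p}\rangle$ if and only if $a^{n+1}=\bot$; (c) if $n<p$, then $\langle\mathbf{n-1},\mathbf{p-1}\rangle^{p-1}=\ \sim\langle\mathbf{n-1},\mathbf{p-1}\rangle$ (i.e. $\langle\mathbf{n-1},\mathbf{p-1}\rangle$ is a cyclic element), and $a\not\ge\langle\mathbf{0},\mathbf{p}\rangle$ if and only if $a^{p}=\bot$.
   Context: Fix integers $n,p>0$. On $\mathbb{Z}\times\mathbb{Z}$ use componentwise addition/subtraction and the lexicographic total order $\preccurlyeq$: $(m,r)\preccurlyeq(k,s)$ iff $m<k$, or $m=k$ and $r\le s$; $\max,\min$ are taken with respect to $\preccurlyeq$. For an integer $j\ge 0$ let $L^\omega_{j+1}=\{(m,r)\in\mathbb{Z}^2:(0,0)\preccurlyeq(m,r)\preccurlyeq(j,0)\}$. On $L^\omega_{n+1}$ put $x*y=\max\{(0,0),x+y-(n,0)\}$ and $x\to y=\min\{(n,0),(n,0)-x+y\}$. Let $L_{p+1}=\{0,1,\dots,p\}$ with the usual order and $\alpha*\beta=\max\{0,\alpha+\beta-p\}$. Let $A=A^{p+1}_{n+1}=(L^\omega_{n+1}\times\{0,p\})\cup(L^\omega_{n}\times\{1,\dots,p-1\})$,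 with elements written $\langle(m,r),\alpha\rangle$; $\bot=\langle(n,0),0\rangle$, $\top=\langle(n,0),p\rangle$. Define $\langle(m,r),\alpha\rangle\le\langle(k,s),\beta\rangle$ iff either (o1) $0<\alpha\le\beta$ and $(m,r)\preccurlyeq(k,s)$; or (o2) $\alpha=\beta=0$ and $(k,s)\preccurlyeq(m,r)$; or (o3) $\alpha=0<\beta$ and $(n-1,0)\preccurlyeq(m+k,r+s)$; $\vee$ is the join. Define the commutative operation $\odot$ on $A$, for $a=\langle(m,r),\alpha\rangle$, $b=\langle(k,s),\beta\rangle$: (i) if $\alpha,\beta>0$ and $\alpha*\beta\neq0$: $a\odot b=\langle(m,r)*(k,s),\alpha*\beta\rangle$; (ii) if $\alpha,\beta>0$ and $\alpha*\beta=0$: $a\odot b=\langle\min\{(n,0),(2n-(m+k+1),-(r+s))\},0\rangle$; (iii) if $\alpha>0$, $\beta=0$: $a\odot b=b\odot a=\langle(m,r)\to(k,s),0\rangle$; (iv) if $\alpha=\beta=0$: $a\odot b=\langle\min\{(n,0),(m+k+1,r+s)\},0\rangle$. Powers: $a^0=\top$, $a^{k+1}=a\odot a^k$. Define $\sim\langle(m,r),\alpha\rangle=\langle(m,r),p-\alpha\rangle$ if $\alpha\in\{0,p\}$, and $=\langle(n-1-m,-r),p-\alpha\rangle$ otherwise; $x\multimap y=\sim(x\odot\sim y)$; $\mathbf{A}=\langle A;\odot,\multimap,\wedge,\vee,\bot,\top\rangle$. An implicative filter is a subset $F\subseteq A$ with $\top\in F$, closed under $\odot$, and upward closed; $\mathrm{Rad}(\mathbf{A})$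 is the intersection of all maximal proper implicative filters. -}

module Defs where

open import Data.Nat as ℕ using (ℕ; zero; suc; _∸_)
open import Data.Integer as ℤ using (ℤ; +_; -_)
open import Data.Bool using (Bool; true; false; if_then_else_; _∨_; _∧_)
open import Data.Product using (_×_; _,_; Σ; ∃)
open import Data.Sum using (_⊎_)
open import Relation.Nullary using (¬_)
open import Relation.Nullary.Decidable using (⌊_⌋)
open import Relation.Binary.PropositionalEquality using (_≡_)

Z² : Set
Z² = ℤ × ℤ

_⊕_ : Z² → Z² → Z²
(m , r) ⊕ (k , s) = (m ℤ.+ k , r ℤ.+ s)

_⊖_ : Z² → Z² → Z²
(m , r) ⊖ (k , s) = (m ℤ.- k , r ℤ.- s)

_≼_ : Z² → Z² → Set
(m , r) ≼ (k , s) = (m ℤ.< k) ⊎ (m ≡ k × r ℤ.≤ s)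

_≼ᵇ_ : Z² → Z² → Bool
(m , r) ≼ᵇ (k , s) = ⌊ m ℤ.<? k ⌋ ∨ (⌊ m ℤ.≟ k ⌋ ∧ ⌊ r ℤ.≤? s ⌋)

maxL : Z² → Z² → Z²
maxL x y = if x ≼ᵇ y then y else x

minL : Z² → Z² → Z²
minL x y = if x ≼ᵇ y then x else y

pt : ℤ → Z²
pt j = (j , + 0)

-- L^ω_{j+1} = {(m,r) : (0,0) ≼ (m,r) ≼ (j,0)}
InL : ℤ → Z² → Set
InL j x = (pt (+ 0) ≼ x) × (x ≼ pt j)

-- The algebra A^{p+1}_{n+1}; parameters n p : ℕ (assumed > 0 in the theorem)

El : Set
El = Z² × ℕ

module Alg (n p : ℕ) where

  N : ℤ
  N = + n

  N-1 : ℤ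
  N-1 = + n ℤ.- + 1

  _*L_ : Z² → Z² → Z²
  x *L y = maxL (pt (+ 0)) ((x ⊕ y) ⊖ pt N)

  _→L_ : Z² → Z² → Z²
  x →L y = minL (pt N) ((pt N ⊖ x) ⊕ y)

  _*p_ : ℕ → ℕ → ℕ
  α *p β = (α ℕ.+ β) ∸ p

  InA : El → Set
  InA (x , α) = ((α ≡ 0 ⊎ α ≡ p) × InL N x)
              ⊎ ((0 ℕ.< α) × (α ℕ.< p) × InL N-1 x)

  ⊥A ⊤A : El
  ⊥A = (pt N , 0)
  ⊤A = (pt N , p)

  ⟨_,_⟩ : ℤ → ℕ → El
  ⟨ j , q ⟩ = (pt j , q)

  _≤A_ : El → El → Set
  ((m , r) , α) ≤A ((k , s) , β) =
      ((0 ℕ.< α) × (α ℕ.≤ β) × ((m , r) ≼ (k , s)))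
    ⊎ ((α ≡ 0) × (β ≡ 0) × ((k , s) ≼ (m , r)))
    ⊎ ((α ≡ 0) × (0 ℕ.< β) × (pt N-1 ≼ (m ℤ.+ k , r ℤ.+ s)))

  _⊙_ : El → El → El
  ((m , r) , zero) ⊙ ((k , s) , zero) =
    (minL (pt N) (m ℤ.+ k ℤ.+ + 1 , r ℤ.+ s) , 0)                     -- (iv)
  (x , suc α) ⊙ (y , zero) = (x →L y , 0)                               -- (iii)
  (x , zero) ⊙ (y , suc β) = (y →L x , 0)                               -- (iii)
  ((m , r) , suc α) ⊙ ((k , s) , suc β) with suc α *p suc β
  ... | zero  = (minL (pt N) ((+ 2 ℤ.* N) ℤ.- (m ℤ.+ k ℤ.+ + 1) , ℤ.- (r ℤ.+ s)) , 0)  -- (ii)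
  ... | suc γ = ((m , r) *L (k , s) , suc γ)                            -- (i)

  _^_ : El → ℕ → El
  a ^ zero = ⊤A
  a ^ suc k = a ⊙ (a ^ k)

  ∼_ : El → El
  ∼ ((m , r) , α) =
    if ⌊ α ℕ.≟ 0 ⌋ ∨ ⌊ α ℕ.≟ p ⌋
    then ((m , r) , p ∸ α)
    else ((N-1 ℤ.- m , ℤ.- r) , p ∸ α)

  _⊸_ : El → El → El
  x ⊸ y = ∼ (x ⊙ (∼ y))

  IsJoin : El → El → El → Set
  IsJoin x y z = InA z × (x ≤A z) × (y ≤A z)
               × (∀ w → InA w → x ≤A w → y ≤A w → z ≤A w)

  -- implicative filters, as predicates on A (only their values on A matter)
  record IsImplFilter (F : El → Set) : Set where
    field
      top∈   : F ⊤A
      ⊙-closed : ∀ x y → InA x → InA y → F x → F y → F (x ⊙ y)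
      up-closed : ∀ x y → InA x → InA y → x ≤A y → F x → F y

  Proper : (El → Set) → Set
  Proper F = ∃ λ x → InA x × ¬ F x

  record IsMaximal (F : El → Set) : Set₁ where
    field
      filter : IsImplFilter F
      proper : Proper F
      maximal : ∀ (G : El → Set) → IsImplFilter G → Proper G
              → (∀ x → InA x → F x → G x) → ∀ x → InA x → G x → F x

  InRad : El → Set₁
  InRad a = ∀ (F : El → Set) → IsMaximal F → F a

{-# OPTIONS --safe #-}
-- An element ⟨x, α⟩ with α < p is nilpotent.  While the α-coordinate of its powers
-- is positive it drops by at least one per factor (cases (i)/(ii) of ⊙); once it is 0,
-- every further factor adds N - x ≥ (1,0) to the lattice coordinate, truncated at N
-- (case (iii); for α = 0 case (iv) adds 1 + x).  Counting both phases, max(n + 1, p) factors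
-- reach ⊥, whereas the powers of a top element ⟨x, p⟩ stay in the top layer α = p.
-- So the top layer is a proper implicative filter containing every maximal one, hence
-- equal to each of them and contained in Rad(A).  Since a^p lies in layer 0 for lower
-- a and in layer p for top a, the join a ∨ ∼(a^p) always lies in the top layer.
-- Part (c) computes the powers ⟨n-1-j, p-1-j⟩ of ⟨n-1, p-1⟩ directly.

module Submission where

open import Defs
open import Data.Nat using (ℕ; _<_; _≤_; _∸_)
open import Data.Integer using (+_; _-_)
open import Data.Product using (_×_; ∃)
open import Relation.Nullary using (¬_)
open import Relation.Binary.PropositionalEquality using (_≡_)
open import Function.Bundles using (_⇔_)

open import Data.Bool using (if_then_else_; _∨_; _∧_)
open import Data.Empty using (⊥; ⊥-elim)
open import Data.Integer as ℤ using (ℤ; -_)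
import Data.Integer.Properties as ℤP
open import Data.Integer.Tactic.RingSolver using (solve-∀)
open import Data.Nat as ℕ using (zero; suc; s≤s; z≤n)
import Data.Nat.Properties as ℕP
open import Data.Product using (_,_; proj₁; proj₂)
open import Data.Product.Relation.Binary.Lex.Strict as Lex using ()
open import Data.Product.Relation.Binary.Pointwise.NonDependent using (≡×≡⇒≡)
open import Data.Sum using (_⊎_; inj₁; inj₂; swap)
open import Function.Bundles using (mk⇔)
open import Relation.Binary.Bundles using (Poset)
open import Relation.Binary.Definitions using (Decidable)
open import Relation.Binary.PropositionalEquality as ≡
  using (refl; sym; trans; cong; cong₂; subst)
import Relation.Binary.Reasoning.PartialOrder as PosetReasoning
open import Relation.Nullary using (Dec; yes; no; does)
open import Relation.Nullary.Decidable using (dec-true; dec-false; isYes≗does)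

private variable
  i j : ℤ
  x y z u v d : Z²

O one : Z²
O = pt (+ 0)
one = pt (+ 1)

≼-refl : x ≼ x
≼-refl = inj₂ (refl , ℤP.≤-refl)

≼-reflexive : x ≡ y → x ≼ y
≼-reflexive refl = ≼-refl

-- _≼_ is definitionally Lex.×-Lex _≡_ ℤ._<_ ℤ._≤_, the lexicographic product order.

≼-trans : x ≼ y → y ≼ z → x ≼ z
≼-trans = Lex.×-transitive {_<₂_ = ℤ._≤_}
  ≡.isEquivalence (≡.resp₂ ℤ._<_) ℤP.<-trans ℤP.≤-trans

≼-antisym : x ≼ y → y ≼ x → x ≡ y
≼-antisym x≼y y≼x = ≡×≡⇒≡
  (Lex.×-antisymmetric {_<₁_ = ℤ._<_} {_<₂_ = ℤ._≤_}
     sym ℤP.<-irrefl ℤP.<-asym ℤP.≤-antisym x≼y y≼x)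

≼-total : ∀ x y → x ≼ y ⊎ y ≼ x
≼-total = Lex.×-total₂ sym ℤP.<-cmp ℤP.≤-total

_≼?_ : Decidable _≼_
_≼?_ = Lex.×-decidable ℤ._≟_ ℤ._<?_ ℤ._≤?_

≼-poset : Poset _ _ _
≼-poset = record
  { isPartialOrder = record
    { isPreorder = record
      { isEquivalence = ≡.isEquivalence ; reflexive = ≼-reflexive ; trans = ≼-trans }
    ; antisym = ≼-antisym
    }
  }

module ≼-Reasoning = PosetReasoning ≼-poset

≰⇒≽ : ¬ (x ≼ y) → y ≼ x
≰⇒≽ {x} {y} x⋠y with ≼-total x y
... | inj₁ x≼y = ⊥-elim (x⋠y x≼y)
... | inj₂ y≼x = y≼x

pt-mono-≼ : i ℤ.≤ j → pt i ≼ pt j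
pt-mono-≼ {i} {j} i≤j with i ℤ.≟ j
... | yes refl = ≼-refl
... | no i≢j = inj₁ (ℤP.≤∧≢⇒< i≤j i≢j)

if-does : ∀ {A B : Set} (a? : Dec A) {b c : B} →
          (A × (if does a? then b else c) ≡ b) ⊎ (¬ A × (if does a? then b else c) ≡ c)
if-does (yes a) = inj₁ (a , refl)
if-does (no ¬a) = inj₂ (¬a , refl)

≼ᵇ≡does : ∀ x y → x ≼ᵇ y ≡ does (x ≼? y)
≼ᵇ≡does (m , r) (k , s) =
  cong₂ _∨_ (isYes≗does (m ℤ.<? k))
            (cong₂ _∧_ (isYes≗does (m ℤ.≟ k)) (isYes≗does (r ℤ.≤? s)))

maxL-≡-if : ∀ x y → maxL x y ≡ (if does (x ≼? y) then y else x)
maxL-≡-if x y = cong (λ b → if b then y else x) (≼ᵇ≡does x y)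

minL-≡-if : ∀ x y → minL x y ≡ (if does (x ≼? y) then x else y)
minL-≡-if x y = cong (λ b → if b then x else y) (≼ᵇ≡does x y)

maxL-sel : ∀ x y → (x ≼ y × maxL x y ≡ y) ⊎ (y ≼ x × maxL x y ≡ x)
maxL-sel x y with if-does (x ≼? y) {y} {x}
... | inj₁ (x≼y , eq) = inj₁ (x≼y , trans (maxL-≡-if x y) eq)
... | inj₂ (x⋠y , eq) = inj₂ (≰⇒≽ x⋠y , trans (maxL-≡-if x y) eq)

minL-sel : ∀ x y → (x ≼ y × minL x y ≡ x) ⊎ (y ≼ x × minL x y ≡ y)
minL-sel x y with if-does (x ≼? y) {x} {y}
... | inj₁ (x≼y , eq) = inj₁ (x≼y , trans (minL-≡-if x y) eq)
... | inj₂ (x⋠y , eq) = inj₂ (≰⇒≽ x⋠y , trans (minL-≡-if x y) eq)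

maxL-elim : ∀ (P : Z² → Set) → P x → P y → P (maxL x y)
maxL-elim {x} {y} P px py with maxL-sel x y
... | inj₁ (_ , eq) = subst P (sym eq) py
... | inj₂ (_ , eq) = subst P (sym eq) px

minL-elim : ∀ (P : Z² → Set) → P x → P y → P (minL x y)
minL-elim {x} {y} P px py with minL-sel x y
... | inj₁ (_ , eq) = subst P (sym eq) px
... | inj₂ (_ , eq) = subst P (sym eq) py

maxL-≥ˡ : x ≼ maxL x y
maxL-≥ˡ {x} {y} with maxL-sel x y
... | inj₁ (x≼y , eq) = subst (x ≼_) (sym eq) x≼y
... | inj₂ (_ , eq) = subst (x ≼_) (sym eq) ≼-refl

maxL-≥ʳ : y ≼ maxL x y
maxL-≥ʳ {y} {x} with maxL-sel x y
... | inj₁ (_ , eq) = subst (y ≼_) (sym eq) ≼-refl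
... | inj₂ (y≼x , eq) = subst (y ≼_) (sym eq) y≼x

maxL-≡ʳ : x ≼ y → maxL x y ≡ y
maxL-≡ʳ {x} {y} x≼y with maxL-sel x y
... | inj₁ (_ , eq) = eq
... | inj₂ (y≼x , eq) = trans eq (≼-antisym x≼y y≼x)

maxL-≡ˡ : y ≼ x → maxL x y ≡ x
maxL-≡ˡ {y} {x} y≼x with maxL-sel x y
... | inj₁ (x≼y , eq) = trans eq (≼-antisym y≼x x≼y)
... | inj₂ (_ , eq) = eq

maxL-O-⊖ : ∀ m k → maxL O (pt (m ℤ.⊖ k)) ≡ pt (+ (m ∸ k))
maxL-O-⊖ m k with ℕP.≤-total k m
... | inj₁ k≤m rewrite ℤP.⊖-≥ k≤m = maxL-≡ʳ (pt-mono-≼ (ℤ.+≤+ z≤n))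
... | inj₂ m≤k rewrite ℤP.⊖-≤ m≤k | ℕP.m≤n⇒m∸n≡0 m≤k =
  maxL-≡ˡ (pt-mono-≼ ℤP.neg-≤-pos)

minL-≤ˡ : minL x y ≼ x
minL-≤ˡ {x} {y} with minL-sel x y
... | inj₁ (_ , eq) = subst (_≼ x) (sym eq) ≼-refl
... | inj₂ (y≼x , eq) = subst (_≼ x) (sym eq) y≼x

minL-≡ʳ : y ≼ x → minL x y ≡ y
minL-≡ʳ {y} {x} y≼x with minL-sel x y
... | inj₁ (x≼y , eq) = trans eq (≼-antisym x≼y y≼x)
... | inj₂ (_ , eq) = eq

⊕-identityˡ : ∀ x → O ⊕ x ≡ x
⊕-identityˡ (m , r) = cong₂ _,_ (ℤP.+-identityˡ m) (ℤP.+-identityˡ r)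

⊕-identityʳ : ∀ x → x ⊕ O ≡ x
⊕-identityʳ (m , r) = cong₂ _,_ (ℤP.+-identityʳ m) (ℤP.+-identityʳ r)

⊕-comm : ∀ x y → x ⊕ y ≡ y ⊕ x
⊕-comm (m , r) (k , s) = cong₂ _,_ (ℤP.+-comm m k) (ℤP.+-comm r s)

⊕-assoc : ∀ x y z → (x ⊕ y) ⊕ z ≡ x ⊕ (y ⊕ z)
⊕-assoc (m , r) (k , s) (l , t) = cong₂ _,_ (ℤP.+-assoc m k l) (ℤP.+-assoc r s t)

x⊖x≡O : ∀ x → x ⊖ x ≡ O
x⊖x≡O (m , r) = cong₂ _,_ (ℤP.+-inverseʳ m) (ℤP.+-inverseʳ r)

⊕-⊖-cancelʳ : ∀ x y → (x ⊕ y) ⊖ y ≡ x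
⊕-⊖-cancelʳ (m , r) (k , s) = cong₂ _,_ (lemma m k) (lemma r s)
  where
  lemma : ∀ a b → (a ℤ.+ b) ℤ.- b ≡ a
  lemma = solve-∀

⊕-⊖-cancelˡ : ∀ x y → (x ⊕ y) ⊖ x ≡ y
⊕-⊖-cancelˡ x y = trans (cong (_⊖ x) (⊕-comm x y)) (⊕-⊖-cancelʳ y x)

⊖-⊕-cancelʳ : ∀ x y → (x ⊖ y) ⊕ y ≡ x
⊖-⊕-cancelʳ (m , r) (k , s) = cong₂ _,_ (lemma m k) (lemma r s)
  where
  lemma : ∀ a b → (a ℤ.- b) ℤ.+ b ≡ a
  lemma = solve-∀

⊖-⊕-cancelˡ : ∀ x y → y ⊕ (x ⊖ y) ≡ x
⊖-⊕-cancelˡ x y = trans (⊕-comm y (x ⊖ y)) (⊖-⊕-cancelʳ x y)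

[x⊕y]⊕z≡y⊕[x⊕z] : ∀ x y z → (x ⊕ y) ⊕ z ≡ y ⊕ (x ⊕ z)
[x⊕y]⊕z≡y⊕[x⊕z] x y z = trans (cong (_⊕ z) (⊕-comm x y)) (⊕-assoc y x z)

[x⊕y]⊕z≡[x⊕z]⊕y : ∀ x y z → (x ⊕ y) ⊕ z ≡ (x ⊕ z) ⊕ y
[x⊕y]⊕z≡[x⊕z]⊕y x y z =
  trans (⊕-assoc x y z) (trans (cong (x ⊕_) (⊕-comm y z)) (sym (⊕-assoc x z y)))

[[x⊕y]⊖z]⊕[z⊖x]≡y : ∀ x y z → ((x ⊕ y) ⊖ z) ⊕ (z ⊖ x) ≡ y
[[x⊕y]⊖z]⊕[z⊖x]≡y (m , r) (k , s) (l , t) = cong₂ _,_ (lemma m k l) (lemma r s t)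
  where
  lemma : ∀ a b c → ((a ℤ.+ b) ℤ.- c) ℤ.+ (c ℤ.- a) ≡ b
  lemma = solve-∀

⊕-mono-≼ : x ≼ y → u ≼ v → (x ⊕ u) ≼ (y ⊕ v)
⊕-mono-≼ (inj₁ x₁<y₁) (inj₁ u₁<v₁) = inj₁ (ℤP.+-mono-< x₁<y₁ u₁<v₁)
⊕-mono-≼ {u = u} (inj₁ x₁<y₁) (inj₂ (refl , _)) = inj₁ (ℤP.+-monoˡ-< (proj₁ u) x₁<y₁)
⊕-mono-≼ {x = x} (inj₂ (refl , _)) (inj₁ u₁<v₁) = inj₁ (ℤP.+-monoʳ-< (proj₁ x) u₁<v₁)
⊕-mono-≼ (inj₂ (refl , x₂≤y₂)) (inj₂ (refl , u₂≤v₂)) =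
  inj₂ (refl , ℤP.+-mono-≤ x₂≤y₂ u₂≤v₂)

⊕-monoʳ-≼ : ∀ x → u ≼ v → (x ⊕ u) ≼ (x ⊕ v)
⊕-monoʳ-≼ x = ⊕-mono-≼ (≼-refl {x})

⊖-monoˡ-≼ : ∀ z → x ≼ y → (x ⊖ z) ≼ (y ⊖ z)
⊖-monoˡ-≼ z x≼y = ⊕-mono-≼ x≼y ≼-refl

⊕-cancelʳ-≼ : ∀ z → (x ⊕ z) ≼ (y ⊕ z) → x ≼ y
⊕-cancelʳ-≼ {x} {y} z h = begin
  x            ≡⟨ ⊕-⊖-cancelʳ x z ⟨
  (x ⊕ z) ⊖ z  ≤⟨ ⊖-monoˡ-≼ z h ⟩
  (y ⊕ z) ⊖ z  ≡⟨ ⊕-⊖-cancelʳ y z ⟩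
  y            ∎
  where open ≼-Reasoning

≼-⊕ʳ : O ≼ y → x ≼ (x ⊕ y)
≼-⊕ʳ {y} {x} O≼y = subst (_≼ (x ⊕ y)) (⊕-identityʳ x) (⊕-monoʳ-≼ x O≼y)

≼-⊕ˡ : O ≼ x → y ≼ (x ⊕ y)
≼-⊕ˡ {x} {y} O≼x = subst (_≼ (x ⊕ y)) (⊕-identityˡ y) (⊕-mono-≼ O≼x ≼-refl)

⊖-≼ : O ≼ x → (y ⊖ x) ≼ y
⊖-≼ {x} {y} O≼x = ⊕-cancelʳ-≼ x (subst (_≼ (y ⊕ x)) (sym (⊖-⊕-cancelʳ y x)) (≼-⊕ʳ O≼x))

infixr 25 _·_

_·_ : ℕ → Z² → Z²
zero  · d = O
suc c · d = d ⊕ (c · d)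

·-nonneg : O ≼ d → ∀ c → O ≼ (c · d)
·-nonneg O≼d zero    = ≼-refl
·-nonneg O≼d (suc c) = ⊕-mono-≼ O≼d (·-nonneg O≼d c)

pt≼· : one ≼ d → ∀ c → pt (+ c) ≼ (c · d)
pt≼· one≼d zero    = ≼-refl
pt≼· one≼d (suc c) = ⊕-mono-≼ one≼d (pt≼· one≼d c)

module Properties (n' p' : ℕ) where
  open Alg (suc n') (suc p')

  private
    n p : ℕ
    n = suc n'
    p = suc p'

    variable
      a w : El
      α β γ k c T : ℕ
      F : El → Set

  O≼N : O ≼ pt N
  O≼N = pt-mono-≼ (ℤ.+≤+ z≤n)

  N-1≼N : pt N-1 ≼ pt N
  N-1≼N = pt-mono-≼ (ℤ.+≤+ (ℕP.n≤1+n n'))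

  one≼N⊖x : x ≼ pt N-1 → one ≼ (pt N ⊖ x)
  one≼N⊖x {x} x≼N-1 = ⊕-cancelʳ-≼ x (begin
    one ⊕ x         ≤⟨ ⊕-monoʳ-≼ one x≼N-1 ⟩
    one ⊕ pt N-1    ≡⟨⟩
    pt N            ≡⟨ ⊖-⊕-cancelʳ (pt N) x ⟨
    (pt N ⊖ x) ⊕ x  ∎)
    where open ≼-Reasoning

  ⊥∈A : InA ⊥A
  ⊥∈A = inj₁ (inj₁ refl , O≼N , ≼-refl)

  ⊤∈A : InA ⊤A
  ⊤∈A = inj₁ (inj₂ refl , O≼N , ≼-refl)

  InA⇒InL : InA (x , α) → InL N x
  InA⇒InL (inj₁ (_ , x∈L)) = x∈L
  InA⇒InL (inj₂ (_ , _ , O≼x , x≼N-1)) = O≼x , ≼-trans x≼N-1 N-1≼N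

  InA⇒≤p : InA (x , α) → α ≤ p
  InA⇒≤p (inj₁ (inj₁ refl , _)) = z≤n
  InA⇒≤p (inj₁ (inj₂ refl , _)) = ℕP.≤-refl
  InA⇒≤p (inj₂ (_ , α<p , _))   = ℕP.<⇒≤ α<p

  top-or-lower : InA (x , α) → α ≡ p ⊎ α < p
  top-or-lower x∈A = swap (ℕP.m≤n⇒m<n∨m≡n (InA⇒≤p x∈A))

  ≥p⇒top : InA (x , α) → p ≤ α → α ≡ p
  ≥p⇒top x∈A p≤α = ℕP.≤-antisym (InA⇒≤p x∈A) p≤α

  ⊙-i : suc α *p suc β ≡ suc γ → (x , suc α) ⊙ (y , suc β) ≡ (x *L y , suc γ)
  ⊙-i {α} {β} eq with suc α *p suc β
  ⊙-i refl | _ = refl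

  ⊙-ii : suc α *p suc β ≡ 0 →
         (x , suc α) ⊙ (y , suc β) ≡ (minL (pt N) ((pt N ⊕ (pt N ⊖ x)) ⊖ (one ⊕ y)) , 0)
  ⊙-ii {α} {β} {m , r} {k , s} eq with suc α *p suc β
  ⊙-ii {α} {β} {m , r} {k , s} refl | _ =
    cong (λ t → minL (pt N) t , 0) (cong₂ _,_ (lemma₁ N m k) (lemma₂ r s))
    where
    lemma₁ : ∀ a b c →
             (+ 2 ℤ.* a) ℤ.- (b ℤ.+ c ℤ.+ + 1) ≡ (a ℤ.+ (a ℤ.- b)) ℤ.- (+ 1 ℤ.+ c)
    lemma₁ = solve-∀
    lemma₂ : ∀ a b → ℤ.- (a ℤ.+ b) ≡ (+ 0 ℤ.+ (+ 0 ℤ.- a)) ℤ.- (+ 0 ℤ.+ b)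
    lemma₂ = solve-∀

  ⊙-iv : (x , 0) ⊙ (y , 0) ≡ (minL (pt N) ((one ⊕ x) ⊕ y) , 0)
  ⊙-iv {m , r} {k , s} = cong (λ t → minL (pt N) t , 0) (cong₂ _,_ (lemma₁ m k) (lemma₂ r s))
    where
    lemma₁ : ∀ a b → a ℤ.+ b ℤ.+ + 1 ≡ (+ 1 ℤ.+ a) ℤ.+ b
    lemma₁ = solve-∀
    lemma₂ : ∀ a b → a ℤ.+ b ≡ (+ 0 ℤ.+ a) ℤ.+ b
    lemma₂ = solve-∀

  *L-≼ˡ : O ≼ x → y ≼ pt N → (x *L y) ≼ x
  *L-≼ˡ {x} {y} O≼x y≼N = maxL-elim (_≼ x) O≼x (begin
    (x ⊕ y) ⊖ pt N     ≤⟨ ⊖-monoˡ-≼ (pt N) (⊕-monoʳ-≼ x y≼N) ⟩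
    (x ⊕ pt N) ⊖ pt N  ≡⟨ ⊕-⊖-cancelʳ x (pt N) ⟩
    x                  ∎)
    where open ≼-Reasoning

  *L-InL : InL N x → y ≼ pt N → InL N (x *L y)
  *L-InL {x} {y} (O≼x , x≼N) y≼N =
    maxL-≥ˡ {y = (x ⊕ y) ⊖ pt N} , ≼-trans (*L-≼ˡ O≼x y≼N) x≼N

  ⊙-identityʳ : InA a → a ⊙ ⊤A ≡ a
  ⊙-identityʳ {x , zero} a∈A = begin
    (x , 0) ⊙ ⊤A
      ≡⟨⟩
    (minL (pt N) ((pt N ⊖ pt N) ⊕ x) , 0)
      ≡⟨ cong (λ t → minL (pt N) (t ⊕ x) , 0) (x⊖x≡O (pt N)) ⟩
    (minL (pt N) (O ⊕ x) , 0)
      ≡⟨ cong (λ t → minL (pt N) t , 0) (⊕-identityˡ x) ⟩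
    (minL (pt N) x , 0)
      ≡⟨ cong (_, 0) (minL-≡ʳ (proj₂ (InA⇒InL a∈A))) ⟩
    (x , 0)
      ∎
    where open ≡.≡-Reasoning
  ⊙-identityʳ {x , suc α} a∈A = begin
    (x , suc α) ⊙ ⊤A          ≡⟨ ⊙-i (ℕP.m+n∸n≡m (suc α) p) ⟩
    (x *L pt N , suc α)       ≡⟨ cong (λ t → maxL O t , suc α) (⊕-⊖-cancelʳ x (pt N)) ⟩
    (maxL O x , suc α)        ≡⟨ cong (_, suc α) (maxL-≡ʳ (proj₁ (InA⇒InL a∈A))) ⟩
    (x , suc α)               ∎
    where open ≡.≡-Reasoning

  -- Powers

  top-layer-^ : InL N x → ∀ k → ∃ λ s → (x , p) ^ k ≡ (s , p) × InL N s
  top-layer-^ x∈L zero = pt N , refl , O≼N , ≼-refl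
  top-layer-^ {x} x∈L (suc k) with top-layer-^ x∈L k
  ... | s , eq , (_ , s≼N) =
    x *L s , trans (cong ((x , p) ⊙_) eq) (⊙-i (ℕP.m+n∸n≡m p p)) , *L-InL x∈L s≼N

  ^-induction : (P : ℕ → ℕ → El → Set) → (∀ {k c w} → P k (suc c) w → P (suc k) c (a ⊙ w)) →
                InA a → ∀ j c → P 1 (c ℕ.+ j) a → P (suc j) c (a ^ suc j)
  ^-induction {a} P step a∈A zero c P-start =
    subst (P 1 c) (sym (⊙-identityʳ a∈A)) (subst (λ m → P 1 m a) (ℕP.+-identityʳ c) P-start)
  ^-induction {a} P step a∈A (suc j) c P-start =
    step (^-induction P step a∈A j (suc c) (subst (λ m → P 1 m a) (ℕP.+-suc c j) P-start))

  -- Invariants for a power of a lower element after k factors, with c factors still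
  -- to come; d is what one factor adds in layer 0, and c · d must suffice to reach N.
  data ZeroPhase (d : Z²) (c : ℕ) : El → Set where
    zero-phase : InL N y → pt N ≼ (y ⊕ (c · d)) → ZeroPhase d c (y , 0)

  data Phase (d : Z²) (k c : ℕ) : El → Set where
    positive : k ℕ.+ suc β ≤ p → suc β ≤ c → InL N-1 y → (one ⊕ y) ≼ (c · d) →
               Phase d k c (y , suc β)
    zeroed   : ZeroPhase d c w → Phase d k c w

  ZeroPhase-minL : O ≼ d → O ≼ y → pt N ≼ (y ⊕ (c · d)) → ZeroPhase d c (minL (pt N) y , 0)
  ZeroPhase-minL {d} {y} {c} O≼d O≼y N≼ = zero-phase
    (minL-elim {pt N} {y} (O ≼_) O≼N O≼y , minL-≤ˡ {pt N} {y})
    (minL-elim {pt N} {y} (λ t → pt N ≼ (t ⊕ (c · d))) (≼-⊕ʳ (·-nonneg O≼d c)) N≼)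

  ZeroPhase-step : O ≼ d → (∀ y → a ⊙ (y , 0) ≡ (minL (pt N) (d ⊕ y) , 0)) →
                   ZeroPhase d (suc c) w → ZeroPhase d c (a ⊙ w)
  ZeroPhase-step {d} {a} {c} O≼d a⊙ (zero-phase {y} (O≼y , _) N≼) =
    subst (ZeroPhase d c) (sym (a⊙ y)) (ZeroPhase-minL O≼d (⊕-mono-≼ O≼d O≼y)
      (subst (pt N ≼_) (sym ([x⊕y]⊕z≡y⊕[x⊕z] d y (c · d))) N≼))

  *p-decreasing : suc α < p → suc α *p suc β ≤ β
  *p-decreasing {α} {β} α<p =
    ℕP.≤-trans (ℕP.∸-monoʳ-≤ (suc α ℕ.+ suc β) α<p) (ℕP.≤-reflexive (begin
    suc α ℕ.+ suc β ∸ suc (suc α)  ≡⟨ cong (_∸ suc α) (ℕP.+-suc α β) ⟩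
    α ℕ.+ β ∸ α                    ≡⟨ ℕP.m+n∸m≡n α β ⟩
    β                              ∎))
    where open ≡.≡-Reasoning

  module ZeroElement {x} (x∈L : InL N x) where
    private
      one≼1+x : one ≼ (one ⊕ x)
      one≼1+x = ≼-⊕ʳ (proj₁ x∈L)

    start : ∀ c → n ≤ c → ZeroPhase (one ⊕ x) c (x , 0)
    start c n≤c = zero-phase x∈L (begin
      pt N                   ≤⟨ pt-mono-≼ (ℤ.+≤+ n≤c) ⟩
      pt (+ c)               ≤⟨ pt≼· one≼1+x c ⟩
      c · (one ⊕ x)          ≤⟨ ≼-⊕ˡ (proj₁ x∈L) ⟩
      x ⊕ (c · (one ⊕ x))    ∎)
      where open ≼-Reasoning

    step : ZeroPhase (one ⊕ x) (suc c) w → ZeroPhase (one ⊕ x) c ((x , 0) ⊙ w)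
    step = ZeroPhase-step {a = x , 0} (≼-trans (pt-mono-≼ (ℤ.+≤+ z≤n)) one≼1+x)
                          (λ y → ⊙-iv {x} {y})

  module MiddleElement {x α} (O≼x : O ≼ x) (x≼N-1 : x ≼ pt N-1) (α<p : suc α < p) where
    private
      D : Z²
      D = pt N ⊖ x

      one≼D : one ≼ D
      one≼D = one≼N⊖x x≼N-1

      O≼D : O ≼ D
      O≼D = ≼-trans (pt-mono-≼ (ℤ.+≤+ z≤n)) one≼D

    start : ∀ c → n ≤ c → p ≤ suc c → Phase D 1 c (x , suc α)
    start c n≤c p≤1+c =
      positive α<p (ℕP.≤-pred (ℕP.<-≤-trans α<p p≤1+c)) (O≼x , x≼N-1) (begin
        one ⊕ x   ≤⟨ ⊕-monoʳ-≼ one x≼N-1 ⟩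
        pt N      ≤⟨ pt-mono-≼ (ℤ.+≤+ n≤c) ⟩
        pt (+ c)  ≤⟨ pt≼· one≼D c ⟩
        c · D     ∎)
      where open ≼-Reasoning

    underflow : InL N-1 y → (one ⊕ y) ≼ (suc c · D) →
                ZeroPhase D c (minL (pt N) ((pt N ⊕ D) ⊖ (one ⊕ y)) , 0)
    underflow {y} {c} (_ , y≼N-1) one⊕y≼ = ZeroPhase-minL O≼D O≼b N≼b⊕cD
      where
      open ≼-Reasoning
      b : Z²
      b = (pt N ⊕ D) ⊖ (one ⊕ y)

      O≼b : O ≼ b
      O≼b = ⊕-cancelʳ-≼ (one ⊕ y) (begin
        O ⊕ (one ⊕ y)  ≡⟨ ⊕-identityˡ (one ⊕ y) ⟩
        one ⊕ y        ≤⟨ ⊕-monoʳ-≼ one y≼N-1 ⟩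
        pt N           ≤⟨ ≼-⊕ʳ O≼D ⟩
        pt N ⊕ D       ≡⟨ ⊖-⊕-cancelʳ (pt N ⊕ D) (one ⊕ y) ⟨
        b ⊕ (one ⊕ y)  ∎)

      N≼b⊕cD : pt N ≼ (b ⊕ (c · D))
      N≼b⊕cD = ⊕-cancelʳ-≼ (one ⊕ y) (begin
        pt N ⊕ (one ⊕ y)           ≤⟨ ⊕-monoʳ-≼ (pt N) one⊕y≼ ⟩
        pt N ⊕ (D ⊕ (c · D))       ≡⟨ ⊕-assoc (pt N) D (c · D) ⟨
        (pt N ⊕ D) ⊕ (c · D)       ≡⟨ cong (_⊕ (c · D)) (⊖-⊕-cancelʳ (pt N ⊕ D) (one ⊕ y)) ⟨
        (b ⊕ (one ⊕ y)) ⊕ (c · D)  ≡⟨ [x⊕y]⊕z≡[x⊕z]⊕y b (one ⊕ y) (c · D) ⟩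
        (b ⊕ (c · D)) ⊕ (one ⊕ y)  ∎)

    descend : InL N-1 y → (one ⊕ y) ≼ (suc c · D) → 1 ≤ c →
              InL N-1 (x *L y) × (one ⊕ (x *L y)) ≼ (c · D)
    descend {y} {c} (_ , y≼N-1) one⊕y≼ 1≤c =
      (maxL-≥ˡ {y = t} , ≼-trans (*L-≼ˡ O≼x (≼-trans y≼N-1 N-1≼N)) x≼N-1) ,
      maxL-elim {O} {t} (λ r → (one ⊕ r) ≼ (c · D)) one≼cD (⊕-cancelʳ-≼ D (begin
        (one ⊕ t) ⊕ D  ≡⟨ ⊕-assoc one t D ⟩
        one ⊕ (t ⊕ D)  ≡⟨ cong (one ⊕_) ([[x⊕y]⊖z]⊕[z⊖x]≡y x y (pt N)) ⟩
        one ⊕ y        ≤⟨ one⊕y≼ ⟩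
        D ⊕ (c · D)    ≡⟨ ⊕-comm D (c · D) ⟩
        (c · D) ⊕ D    ∎))
      where
      open ≼-Reasoning
      t : Z²
      t = (x ⊕ y) ⊖ pt N

      one≼cD : (one ⊕ O) ≼ (c · D)
      one≼cD = ≼-trans (pt-mono-≼ (ℤ.+≤+ 1≤c)) (pt≼· one≼D c)

    step : Phase D k (suc c) w → Phase D (suc k) c ((x , suc α) ⊙ w)
    step (zeroed z) = zeroed (ZeroPhase-step {a = x , suc α} O≼D (λ _ → refl) z)
    step {k} {c} (positive {β} {y} k+β<p β<1+c y∈L one⊕y≼) = by-cases (suc α *p suc β) refl
      where
      by-cases : ∀ γ → suc α *p suc β ≡ γ → Phase D (suc k) c ((x , suc α) ⊙ (y , suc β))
      by-cases zero eq =
        zeroed (subst (ZeroPhase D c) (sym (⊙-ii {x = x} {y} eq)) (underflow y∈L one⊕y≼))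
      by-cases (suc γ) eq =
        subst (Phase D (suc k) c) (sym (⊙-i {x = x} {y} eq))
          (positive 1+k+γ<p γ<c (proj₁ descent) (proj₂ descent))
        where
        γ<β : suc γ ≤ β
        γ<β = subst (_≤ β) eq (*p-decreasing α<p)

        1+k+γ<p : suc k ℕ.+ suc γ ≤ p
        1+k+γ<p = ℕP.≤-trans (s≤s (ℕP.+-monoʳ-≤ k γ<β)) (subst (_≤ p) (ℕP.+-suc k β) k+β<p)

        γ<c : suc γ ≤ c
        γ<c = ℕP.≤-trans γ<β (ℕP.≤-pred β<1+c)

        descent : InL N-1 (x *L y) × (one ⊕ (x *L y)) ≼ (c · D)
        descent = descend y∈L one⊕y≼ (ℕP.≤-trans (s≤s z≤n) γ<c)

  lower-phase : InA (x , α) → α < p → ∀ j c → n ≤ c ℕ.+ j → p ≤ suc (c ℕ.+ j) →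
                ∃ λ d → Phase d (suc j) c ((x , α) ^ suc j)
  lower-phase {x} {zero} x∈A _ j c n≤ _ =
    one ⊕ x , zeroed (^-induction (λ _ → ZeroPhase (one ⊕ x)) Z.step x∈A j c (Z.start (c ℕ.+ j) n≤))
    where module Z = ZeroElement (InA⇒InL x∈A)
  lower-phase {x} {suc α} x∈A@(inj₂ (_ , α<p , O≼x , x≼N-1)) _ j c n≤ p≤ =
    pt N ⊖ x , ^-induction (Phase (pt N ⊖ x)) M.step x∈A j c (M.start (c ℕ.+ j) n≤ p≤)
    where module M = MiddleElement O≼x x≼N-1 α<p
  lower-phase {x} {suc α} (inj₁ (inj₂ refl , _)) α<p _ _ _ _ = ⊥-elim (ℕP.<-irrefl refl α<p)
  lower-phase {x} {suc α} (inj₁ (inj₁ () , _)) _ _ _ _ _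

  Phase⇒InA : Phase d (suc k) c w → InA w
  Phase⇒InA {k = k} (positive {β} k+β<p _ y∈L _) =
    inj₂ (s≤s z≤n , ℕP.≤-trans (s≤s (ℕP.m≤n+m (suc β) k)) k+β<p , y∈L)
  Phase⇒InA (zeroed (zero-phase y∈L _)) = inj₁ (inj₁ refl , y∈L)

  Phase⇒zero-layer : p ≤ k → Phase d k c w → ∃ λ y → w ≡ (y , 0) × InL N y
  Phase⇒zero-layer {k = k} p≤k (positive k+β<p _ _ _) =
    ⊥-elim (ℕP.m+1+n≰m k (ℕP.≤-trans k+β<p p≤k))
  Phase⇒zero-layer _ (zeroed (zero-phase {y} y∈L _)) = y , refl , y∈L

  Phase-0⇒⊥ : Phase d k 0 w → w ≡ ⊥A
  Phase-0⇒⊥ (zeroed (zero-phase {y} (_ , y≼N) N≼y⊕O)) =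
    cong (_, 0) (≼-antisym y≼N (subst (pt N ≼_) (⊕-identityʳ y) N≼y⊕O))

  lower-^-InA : InA (x , α) → α < p → ∀ j → InA ((x , α) ^ j)
  lower-^-InA _ _ zero = ⊤∈A
  lower-^-InA x∈A α<p (suc j) = Phase⇒InA (proj₂ (lower-phase x∈A α<p j (n ℕ.+ p) n≤ p≤))
    where
    n≤ : n ≤ n ℕ.+ p ℕ.+ j
    n≤ = ℕP.≤-trans (ℕP.m≤m+n n p) (ℕP.m≤m+n (n ℕ.+ p) j)
    p≤ : p ≤ suc (n ℕ.+ p ℕ.+ j)
    p≤ = ℕP.≤-trans (ℕP.m≤n+m p n) (ℕP.≤-trans (ℕP.m≤m+n (n ℕ.+ p) j) (ℕP.n≤1+n _))

  lower-^p-zero-layer : InA (x , α) → α < p → ∃ λ y → (x , α) ^ p ≡ (y , 0) × InL N y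
  lower-^p-zero-layer x∈A α<p =
    Phase⇒zero-layer ℕP.≤-refl
      (proj₂ (lower-phase x∈A α<p p' n (ℕP.m≤m+n n p') (s≤s (ℕP.m≤n+m p' n))))

  lower-^-⊥ : InA (x , α) → α < p → ∀ T → n < T → p ≤ T → (x , α) ^ T ≡ ⊥A
  lower-^-⊥ x∈A α<p (suc j) n<T p≤T =
    Phase-0⇒⊥ (proj₂ (lower-phase x∈A α<p j 0 (ℕP.≤-pred n<T) p≤T))

  ^-InA : InA (x , α) → ∀ j → InA ((x , α) ^ j)
  ^-InA x∈A j with top-or-lower x∈A
  ... | inj₂ α<p = lower-^-InA x∈A α<p j
  ... | inj₁ refl with top-layer-^ (InA⇒InL x∈A) j
  ...   | _ , eq , y∈L = subst InA (sym eq) (inj₁ (inj₂ refl , y∈L))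

  -- The radical

  TopLayer : El → Set
  TopLayer w = proj₂ w ≡ p

  ⊥-least : InA w → ⊥A ≤A w
  ⊥-least {y , zero}  w∈A = inj₂ (inj₁ (refl , refl , proj₂ (InA⇒InL w∈A)))
  ⊥-least {y , suc β} w∈A =
    inj₂ (inj₂ (refl , s≤s z≤n , ≼-trans N-1≼N (≼-⊕ʳ (proj₁ (InA⇒InL w∈A)))))

  TopLayer-isImplFilter : IsImplFilter TopLayer
  TopLayer-isImplFilter = record
    { top∈      = refl
    ; ⊙-closed  = λ { (x , _) (y , _) _ _ refl refl →
                      cong proj₂ (⊙-i {x = x} {y} (ℕP.m+n∸n≡m p p)) }
    ; up-closed = up-closed
    }
    where
    up-closed : ∀ u w → InA u → InA w → u ≤A w → TopLayer u → TopLayer w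
    up-closed _ _ _ w∈A (inj₁ (_ , p≤β , _)) refl = ≥p⇒top w∈A p≤β
    up-closed _ _ _ _ (inj₂ (inj₁ (() , _))) refl
    up-closed _ _ _ _ (inj₂ (inj₂ (() , _))) refl

  TopLayer-proper : Proper TopLayer
  TopLayer-proper = ⊥A , ⊥∈A , λ ()

  filter-^ : IsImplFilter F → InA a → F a → ∀ j → F (a ^ j)
  filter-^ F-filter a∈A Fa zero    = IsImplFilter.top∈ F-filter
  filter-^ F-filter a∈A Fa (suc j) =
    IsImplFilter.⊙-closed F-filter _ _ a∈A (^-InA a∈A j) Fa (filter-^ F-filter a∈A Fa j)

  lower∉maximal : IsMaximal F → InA (x , α) → α < p → ¬ F (x , α)
  lower∉maximal {F} F-max x∈A α<p Fx with IsMaximal.proper F-max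
  ... | v , v∈A , v∉F = v∉F (up-closed ⊥A v ⊥∈A v∈A (⊥-least v∈A) F⊥)
    where
    open IsImplFilter (IsMaximal.filter F-max)
    F⊥ : F ⊥A
    F⊥ = subst F (lower-^-⊥ x∈A α<p (n ℕ.+ p) (ℕP.m<m+n n (s≤s z≤n)) (ℕP.m≤n+m p n))
               (filter-^ (IsMaximal.filter F-max) x∈A Fx (n ℕ.+ p))

  TopLayer⊆Rad : InA w → TopLayer w → InRad w
  TopLayer⊆Rad w∈A top F F-max =
    IsMaximal.maximal F-max TopLayer TopLayer-isImplFilter TopLayer-proper F⊆TopLayer _ w∈A top
    where
    F⊆TopLayer : ∀ u → InA u → F u → TopLayer u
    F⊆TopLayer u u∈A Fu with top-or-lower u∈A
    ... | inj₁ top = top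
    ... | inj₂ α<p = ⊥-elim (lower∉maximal F-max u∈A α<p Fu)

  IsJoin-comm : ∀ {a b j} → IsJoin a b j → IsJoin b a j
  IsJoin-comm (j∈A , a≤j , b≤j , least) =
    j∈A , b≤j , a≤j , λ w w∈A b≤w a≤w → least w w∈A a≤w b≤w

  join-zero-top : O ≼ x → InL N y → IsJoin (x , 0) (y , p) (maxL (pt N-1 ⊖ x) y , p)
  join-zero-top {x} {y} O≼x (O≼y , y≼N) =
      inj₁ (inj₂ refl , ≼-trans O≼y (maxL-≥ʳ {y} {xᶜ}) ,
            maxL-elim {xᶜ} {y} (_≼ pt N) (≼-trans (⊖-≼ O≼x) N-1≼N) y≼N)
    , inj₂ (inj₂ (refl , s≤s z≤n , (begin
        pt N-1            ≡⟨ ⊖-⊕-cancelˡ (pt N-1) x ⟨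
        x ⊕ xᶜ            ≤⟨ ⊕-monoʳ-≼ x (maxL-≥ˡ {xᶜ} {y}) ⟩
        x ⊕ maxL xᶜ y     ∎)))
    , inj₁ (s≤s z≤n , ℕP.≤-refl , maxL-≥ʳ {y} {xᶜ})
    , least
    where
    open ≼-Reasoning
    xᶜ : Z²
    xᶜ = pt N-1 ⊖ x

    least : ∀ w → InA w → (x , 0) ≤A w → (y , p) ≤A w → (maxL xᶜ y , p) ≤A w
    least (_ , β) w∈A _ (inj₁ (_ , p≤β , _)) with ≥p⇒top w∈A p≤β
    least (w , _) _ (inj₂ (inj₂ (_ , _ , N-1≼x⊕w))) (inj₁ (_ , _ , y≼w)) | refl =
      inj₁ (s≤s z≤n , ℕP.≤-refl , maxL-elim (_≼ w) xᶜ≼w y≼w)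
      where
      xᶜ≼w : xᶜ ≼ w
      xᶜ≼w = subst (xᶜ ≼_) (⊕-⊖-cancelˡ x w) (⊖-monoˡ-≼ x N-1≼x⊕w)
    least _ _ (inj₁ (() , _)) (inj₁ _) | refl
    least _ _ (inj₂ (inj₁ (_ , () , _))) (inj₁ _) | refl
    least _ _ _ (inj₂ (inj₁ (() , _)))
    least _ _ _ (inj₂ (inj₂ (() , _)))

  join-pos-top : suc α ≤ p → x ≼ pt N → InL N y → IsJoin (x , suc α) (y , p) (maxL x y , p)
  join-pos-top {α} {x} {y} α≤p x≼N (O≼y , y≼N) =
      inj₁ (inj₂ refl , ≼-trans O≼y (maxL-≥ʳ {y} {x}) , maxL-elim {x} {y} (_≼ pt N) x≼N y≼N)
    , inj₁ (s≤s z≤n , α≤p , maxL-≥ˡ {x} {y})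
    , inj₁ (s≤s z≤n , ℕP.≤-refl , maxL-≥ʳ {y} {x})
    , least
    where
    least : ∀ w → InA w → (x , suc α) ≤A w → (y , p) ≤A w → (maxL x y , p) ≤A w
    least (w , _) _ (inj₁ (_ , _ , x≼w)) (inj₁ (_ , p≤β , y≼w)) =
      inj₁ (s≤s z≤n , p≤β , maxL-elim (_≼ w) x≼w y≼w)
    least _ _ (inj₂ (inj₁ (() , _))) _
    least _ _ (inj₂ (inj₂ (() , _))) _
    least _ _ (inj₁ _) (inj₂ (inj₁ (() , _)))
    least _ _ (inj₁ _) (inj₂ (inj₂ (() , _)))

  join-with-top : InA (x , α) → InL N y → ∃ λ j → IsJoin (x , α) (y , p) j × InRad j
  join-with-top {α = zero} x∈A y∈L =
    let join = join-zero-top (proj₁ (InA⇒InL x∈A)) y∈L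
    in _ , join , TopLayer⊆Rad (proj₁ join) refl
  join-with-top {α = suc α} x∈A y∈L =
    let join = join-pos-top (InA⇒≤p x∈A) (proj₂ (InA⇒InL x∈A)) y∈L
    in _ , join , TopLayer⊆Rad (proj₁ join) refl

  ∼-top : ∀ y → ∼ (y , p) ≡ (y , 0)
  ∼-top y = trans
    (cong (λ b → if b then (y , p ∸ p) else ((N-1 ℤ.- proj₁ y , - proj₂ y) , p ∸ p))
          (trans (isYes≗does (p ℕ.≟ p)) (dec-true (p ℕ.≟ p) refl)))
    (cong (y ,_) (ℕP.n∸n≡0 p))

  radical-join : InA (x , α) → ∃ λ j → IsJoin (x , α) (∼ ((x , α) ^ p)) j × InRad j
  radical-join {x} {α} x∈A with top-or-lower x∈A
  ... | inj₁ refl =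
    let s , x^p≡s , s∈L = top-layer-^ (InA⇒InL x∈A) p
        j , join , j∈Rad = join-with-top {s} {0} (inj₁ (inj₁ refl , s∈L)) (InA⇒InL x∈A)
    in j , subst (λ b → IsJoin (x , p) b j) (sym (trans (cong ∼_ x^p≡s) (∼-top s))) (IsJoin-comm join)
         , j∈Rad
  ... | inj₂ α<p =
    let y , x^p≡y , y∈L = lower-^p-zero-layer x∈A α<p
        j , join , j∈Rad = join-with-top x∈A y∈L
    in j , subst (λ b → IsJoin (x , α) (∼ b) j) (sym x^p≡y) join , j∈Rad

  top-layer-^≢⊥ : InL N x → ∀ T → (x , p) ^ T ≡ ⊥A → ⊥
  top-layer-^≢⊥ x∈L T x^T≡⊥ with top-layer-^ x∈L T
  ... | _ , x^T≡s , _ with trans (sym x^T≡s) x^T≡⊥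
  ... | ()

  not-above⇒nilpotent : InA (x , α) → n < T → p ≤ T →
                        ¬ (⟨ + 0 , p ⟩ ≤A (x , α)) → (x , α) ^ T ≡ ⊥A
  not-above⇒nilpotent x∈A n<T p≤T not-above with top-or-lower x∈A
  ... | inj₁ refl = ⊥-elim (not-above (inj₁ (s≤s z≤n , ℕP.≤-refl , proj₁ (InA⇒InL x∈A))))
  ... | inj₂ α<p  = lower-^-⊥ x∈A α<p _ n<T p≤T

  nilpotent⇒not-above : InA (x , α) → (x , α) ^ T ≡ ⊥A → ¬ (⟨ + 0 , p ⟩ ≤A (x , α))
  nilpotent⇒not-above {T = T} x∈A x^T≡⊥ (inj₁ (_ , p≤α , _)) with ≥p⇒top x∈A p≤α
  ... | refl = top-layer-^≢⊥ (InA⇒InL x∈A) T x^T≡⊥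
  nilpotent⇒not-above _ _ (inj₂ (inj₁ (() , _)))
  nilpotent⇒not-above _ _ (inj₂ (inj₂ (() , _)))

  not-above⇔nilpotent : InA (x , α) → n < T → p ≤ T →
                        ((¬ (⟨ + 0 , p ⟩ ≤A (x , α))) ⇔ ((x , α) ^ T ≡ ⊥A))
  not-above⇔nilpotent {T = T} x∈A n<T p≤T =
    mk⇔ (not-above⇒nilpotent x∈A n<T p≤T) (nilpotent⇒not-above {T = T} x∈A)

-- The cyclic element

module CyclicElement (n' q : ℕ) where
  open Alg (suc n') (suc (suc q))
  open Properties n' (suc q)

  private
    +∸suc≡pred : ∀ a v → a ℕ.+ v ∸ suc a ≡ ℕ.pred v
    +∸suc≡pred zero    zero    = refl
    +∸suc≡pred zero    (suc v) = refl
    +∸suc≡pred (suc a) v       = +∸suc≡pred a v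

  pt-*L : ∀ i j → pt (+ i) *L pt (+ j) ≡ pt (+ (i ℕ.+ j ∸ suc n'))
  pt-*L i j =
    trans (cong (λ t → maxL O (t , + 0)) (ℤP.m-n≡m⊖n (i ℕ.+ j) (suc n'))) (maxL-O-⊖ (i ℕ.+ j) (suc n'))

  e : El
  e = ⟨ N-1 , suc q ⟩

  e∈A : InA e
  e∈A = inj₂ (s≤s z≤n , ℕP.≤-refl , pt-mono-≼ (ℤ.+≤+ z≤n) , ≼-refl)

  e-powers : ∀ j t → j ℕ.+ t ≡ q → e ^ suc j ≡ (pt (+ (n' ∸ j)) , suc t)
  e-powers zero    t refl = ⊙-identityʳ e∈A
  e-powers (suc j) t j+t≡q = begin
    e ⊙ (e ^ suc j)
      ≡⟨ cong (e ⊙_) (e-powers j (suc t) (trans (ℕP.+-suc j t) j+t≡q)) ⟩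
    e ⊙ (pt (+ (n' ∸ j)) , suc (suc t))
      ≡⟨ ⊙-i {q} {suc t} α*β≡ ⟩
    (pt N-1 *L pt (+ (n' ∸ j)) , suc t)
      ≡⟨ cong (_, suc t) (pt-*L n' (n' ∸ j)) ⟩
    (pt (+ (n' ℕ.+ (n' ∸ j) ∸ suc n')) , suc t)
      ≡⟨ cong (λ m → pt (+ m) , suc t) (+∸suc≡pred n' (n' ∸ j)) ⟩
    (pt (+ ℕ.pred (n' ∸ j)) , suc t)
      ≡⟨ cong (λ m → pt (+ m) , suc t) (ℕP.pred[m∸n]≡m∸[1+n] n' j) ⟩
    (pt (+ (n' ∸ suc j)) , suc t)
      ∎
    where
    open ≡.≡-Reasoning
    α*β≡ : suc q *p suc (suc t) ≡ suc t
    α*β≡ = trans (cong (_∸ suc q) (ℕP.+-suc q (suc t))) (ℕP.m+n∸m≡n q (suc t))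

  ∼e : ∼ e ≡ (O , 1)
  ∼e = trans
    (cong (λ b → if b then (pt N-1 , suc (suc q) ∸ suc q)
                       else ((N-1 ℤ.- N-1 , - + 0) , suc (suc q) ∸ suc q))
          (trans (isYes≗does (suc q ℕ.≟ suc (suc q))) (dec-false (suc q ℕ.≟ suc (suc q)) λ ())))
    (cong₂ _,_ (cong (_, + 0) (ℤP.+-inverseʳ N-1)) (ℕP.m+n∸n≡m 1 q))

  cyclic : n' ≤ q → e ^ suc q ≡ ∼ e
  cyclic n'≤q = begin
    e ^ suc q              ≡⟨ e-powers q 0 (ℕP.+-identityʳ q) ⟩
    (pt (+ (n' ∸ q)) , 1)  ≡⟨ cong (λ m → pt (+ m) , 1) (ℕP.m≤n⇒m∸n≡0 n'≤q) ⟩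
    (O , 1)                ≡⟨ ∼e ⟨
    ∼ e                    ∎
    where open ≡.≡-Reasoning

cyclic-element : (n' p' : ℕ) → suc n' < suc p' →
                 let open Alg (suc n') (suc p') in ⟨ N-1 , p' ⟩ ^ p' ≡ ∼ ⟨ N-1 , p' ⟩
cyclic-element n' (suc q) (s≤s (s≤s n'≤q)) = CyclicElement.cyclic n' q n'≤q

theorem3p4 : (n p : ℕ) → 0 < n → 0 < p →
    let open Alg n p in
    (a : El) → InA a →
      (∃ λ z → IsJoin a (∼ (a ^ p)) z × InRad z)
      × (p ≤ n → ((¬ (⟨ + 0 , p ⟩ ≤A a)) ⇔ (a ^ (n Data.Nat.+ 1) ≡ ⊥A)))
      × (n < p →
          ((⟨ + n - + 1 , p ∸ 1 ⟩ ^ (p ∸ 1) ≡ ∼ ⟨ + n - + 1 , p ∸ 1 ⟩)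
          × ((¬ (⟨ + 0 , p ⟩ ≤A a)) ⇔ (a ^ p ≡ ⊥A))))
theorem3p4 zero     _        () _
theorem3p4 (suc _)  zero     _  ()
theorem3p4 (suc n') (suc p') _  _ a a∈A =
    radical-join a∈A
  , (λ p≤n → not-above⇔nilpotent a∈A (ℕP.m<m+n (suc n') (s≤s z≤n))
                                     (ℕP.≤-trans p≤n (ℕP.m≤m+n (suc n') 1)))
  , (λ n<p → cyclic-element n' p' n<p , not-above⇔nilpotent a∈A n<p ℕP.≤-refl)
  where open Properties n' p'
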